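{- Let $G$ be a $(P_5,\textit{HVN})$-free graph containing an induced $T$-5-wheel $\Sigma$, with the notation below. Then (1) if $R_3$ is not stable then $R_4$ is stable, and if $R_4$ is not stable then $R_3\cup\bar R_3\cup\bar R_{3,x}$ is stable; (2) $R_{2,x}\cup R_{5,x}$ is stable; (3) $Y_2$, $Y_5$, $Y_{1,x}$, $P^2$, $P^3$, $P^4$, $P^{3,x}$ and $T$ are stable sets; (4) $Y_{1,x}$ is anticomplete to $\bar R_3\cup\bar R_{3,x}$.
   Context: Graphs are finite, simple and connected. $P_5$ is the path on 5 vertices; an HVN is a $K_4$ plus a vertex adjacent to exactly two vertices of the $K_4$; $(H_1,H_2)$-free means no induced $H_1$ or $H_2$. A set is stable if it induces no edges; $A$ is anticomplete to $B$ if no vertex of $A$ is adjacent to a vertex of $B$. A $T$-5-wheel is an induced cycle $C=v_1v_2v_3v_4v_5v_1$ together with a vertex $x$ adjacent to exactly $v_1,v_2,v_5$ on $C$; here $\Sigma$ is such an induced subgraph of $G$. Indices are modulo 5. For $u\in V(G)$, $N_C(u)$ and $N_\Sigma(u)$ denote the sets of neighbours of $u$ in $V(C)$ and $V(\Sigma)$. For $i\in\{1,\dots,5\}$, among vertices $u$ with $ux\notin E(G)$ (including $x$): $R_i=\{u: N_C(u)=\{v_{i-1},v_{i+1}\}\}$, $\bar R_i=\{u: N_C(u)=\{v_{i-1},v_i,v_{i+1}\}\}$, $Y_i=\{u: N_C(u)=\{v_{i-2},v_i,v_{i+2}\}\}$, $P^i=\{u: N_C(u)=\{v_{i-1},v_i,v_{i+1},v_{i+2}\}\}$,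 $T=\{u: N_C(u)=V(C)\}$. Further $R_{i,x}=\{u: N_\Sigma(u)=\{v_{i-1},v_{i+1},x\}\}$, $\bar R_{i,x}=\{u: N_\Sigma(u)=\{v_{i-1},v_i,v_{i+1},x\}\}$, $Y_{i,x}=\{u: N_\Sigma(u)=\{v_{i-2},v_i,v_{i+2},x\}\}$, $P^{i,x}=\{u:N_\Sigma(u)=\{v_{i-1},v_i,v_{i+1},v_{i+2},x\}\}$. -}

module Defs where

open import Data.Nat using (ℕ; zero; suc; _≡ᵇ_; _<ᵇ_)
open import Data.Fin using (Fin; zero; suc; toℕ; _≟_)
open import Data.Bool using (Bool; true; false; _∧_; _∨_; not)
open import Data.Product using (Σ; _×_; _,_)
open import Data.Sum using (_⊎_)
open import Relation.Nullary using (¬_; does)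
open import Relation.Binary.PropositionalEquality using (_≡_; _≢_)
open import Function.Definitions using (Injective)

record Graph : Set where
  field
    n      : ℕ
    adj    : Fin n → Fin n → Bool
    sym    : ∀ u w → adj u w ≡ adj w u
    irrefl : ∀ u → adj u u ≡ false

module _ (G : Graph) where
  open Graph G

  data Walk : Fin n → Fin n → Set where
    here : ∀ {u} → Walk u u
    step : ∀ {u w z} → adj u w ≡ true → Walk w z → Walk u z

  Connected : Set
  Connected = ∀ u w → Walk u w

  ContainsInduced : (k : ℕ) → (Fin k → Fin k → Bool) → Set
  ContainsInduced k h =
    Σ (Fin k → Fin n) λ f → Injective _≡_ _≡_ f × (∀ i j → adj (f i) (f j) ≡ h i j)

  Free : (k : ℕ) → (Fin k → Fin k → Bool) → Set
  Free k h = ¬ ContainsInduced k h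

P5adj : Fin 5 → Fin 5 → Bool
P5adj i j = (suc (toℕ i) ≡ᵇ toℕ j) ∨ (suc (toℕ j) ≡ᵇ toℕ i)

-- HVN : K4 on {0,1,2,3} plus vertex 4 adjacent to exactly 0 and 1
HVNadj : Fin 5 → Fin 5 → Bool
HVNadj i j =
  ((a <ᵇ 4) ∧ (b <ᵇ 4) ∧ not (a ≡ᵇ b))
  ∨ ((a ≡ᵇ 4) ∧ (b <ᵇ 2))
  ∨ ((b ≡ᵇ 4) ∧ (a <ᵇ 2))
  where
  a = toℕ i
  b = toℕ j

c1 c2 c3 c4 c5 : Fin 5
c1 = zero
c2 = suc zero
c3 = suc (suc zero)
c4 = suc (suc (suc zero))
c5 = suc (suc (suc (suc zero)))

next : Fin 5 → Fin 5
next zero = c2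
next (suc zero) = c3
next (suc (suc zero)) = c4
next (suc (suc (suc zero))) = c5
next (suc (suc (suc (suc zero)))) = c1

prev : Fin 5 → Fin 5
prev zero = c5
prev (suc zero) = c1
prev (suc (suc zero)) = c2
prev (suc (suc (suc zero))) = c3
prev (suc (suc (suc (suc zero)))) = c4

_==_ : Fin 5 → Fin 5 → Bool
i == j = does (i ≟ j)

C5adj : Fin 5 → Fin 5 → Bool
C5adj i j = (j == next i) ∨ (j == prev i)

record TWheel (G : Graph) : Set where
  open Graph G
  field
    v      : Fin 5 → Fin n
    x      : Fin n
    v-inj  : Injective _≡_ _≡_ v
    cycle  : ∀ i j → adj (v i) (v j) ≡ C5adj i j
    x-nbrs : ∀ j → adj x (v j) ≡ ((j == c1) ∨ (j == c2) ∨ (j == c5))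

module _ (G : Graph) where
  open Graph G

  Stable : (Fin n → Set) → Set
  Stable A = ∀ u w → A u → A w → adj u w ≡ false

  Anticomplete : (Fin n → Set) → (Fin n → Set) → Set
  Anticomplete A B = ∀ u w → A u → B w → adj u w ≡ false

_∪_ : {n : ℕ} → (Fin n → Set) → (Fin n → Set) → (Fin n → Set)
(A ∪ B) u = A u ⊎ B u
infixr 5 _∪_

module Classes {G : Graph} (W : TWheel G) where
  open Graph G
  open TWheel W

  OffC : Fin n → Set
  OffC u = ∀ j → u ≢ v j

  NCis : Fin n → (Fin 5 → Bool) → Set
  NCis u S = ∀ j → adj u (v j) ≡ S j

  Cls : Bool → (Fin 5 → Bool) → Fin n → Set
  Cls b S u = OffC u × (adj u x ≡ b) × NCis u S

  patR patRbar patY patP : Fin 5 → Fin 5 → Bool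
  patR i j    = (j == prev i) ∨ (j == next i)
  patRbar i j = (j == prev i) ∨ (j == i) ∨ (j == next i)
  patY i j    = (j == prev (prev i)) ∨ (j == i) ∨ (j == next (next i))
  patP i j    = (j == prev i) ∨ (j == i) ∨ (j == next i) ∨ (j == next (next i))

  R Rbar Y P Rx Rbarx Yx Px : Fin 5 → Fin n → Set
  R i     = Cls false (patR i)
  Rbar i  = Cls false (patRbar i)
  Y i     = Cls false (patY i)
  P i     = Cls false (patP i)
  Rx i    = Cls true (patR i)
  Rbarx i = Cls true (patRbar i)
  Yx i    = Cls true (patY i)
  Px i    = Cls true (patP i)

  T : Fin n → Set
  T = Cls false (λ _ → true)

module Submission where

open import Defs
open import Data.Bool using (Bool; true; false)
open import Data.Bool.Properties using (¬-not) renaming (_≟_ to _≟ᵇ_)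
open import Data.Empty using (⊥)
open import Data.Fin using (Fin; zero; suc; _<_; _≟_)
open import Data.Fin.Properties using (all?; <-cmp)
open import Data.Nat using (ℕ; s≤s)
open import Data.Product using (_×_; _,_; proj₂)
open import Data.Sum using (inj₁; inj₂; [_,_]′)
open import Data.Vec using (_∷_; []; lookup)
open import Function using (_∘_)
open import Relation.Binary.Definitions using (tri<; tri≈; tri>)
open import Relation.Binary.PropositionalEquality using (_≡_; refl; sym; trans; cong)
open import Relation.Nullary using (¬_; Dec)
open import Relation.Nullary.Decidable using (_×-dec_; _→-dec_; toWitness)

-- Everything comes from forbidding an HVN, a K4 with a fifth vertex seeing
-- exactly two of its vertices.  Two adjacent vertices that both see an edge
-- ab of C and a vertex c of C anticomplete to ab form, with a and b, such a K4
-- with c as fifth vertex; this gives (3), and similar K4's give (2) and (4).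
-- For (1), a vertex c of R₄ sees every vertex u of R₃ ∪ R̄₃ ∪ R̄₃ₓ, since
-- otherwise c v₅ v₁ v₂ u is an induced P5.  Hence an edge in R₄ and an edge
-- in R₃ ∪ R̄₃ ∪ R̄₃ₓ form a K4 in which v₂ sees exactly the latter edge.

module _ {k : ℕ} (h : Fin k → Fin k → Bool) where

  TwinFree : Set
  TwinFree = ∀ i j → (∀ l → h i l ≡ h j l) → i ≡ j

  SimpleTwinFree : Set
  SimpleTwinFree = (∀ i j → h i j ≡ h j i) × (∀ i → h i i ≡ false) × TwinFree

  simpleTwinFree? : Dec SimpleTwinFree
  simpleTwinFree? =
    (all? λ i → all? λ j → h i j ≟ᵇ h j i)
    ×-dec (all? λ i → h i i ≟ᵇ false)
    ×-dec (all? λ i → all? λ j → all? (λ l → h i l ≟ᵇ h j l) →-dec (i ≟ j))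

P5adj-simpleTwinFree : SimpleTwinFree P5adj
P5adj-simpleTwinFree = toWitness {a? = simpleTwinFree? P5adj} _

HVNadj-simpleTwinFree : SimpleTwinFree HVNadj
HVNadj-simpleTwinFree = toWitness {a? = simpleTwinFree? HVNadj} _

module _ {ℓ} {P : Fin 5 → Fin 5 → Set ℓ}
         (p12 : P c1 c2) (p13 : P c1 c3) (p14 : P c1 c4) (p15 : P c1 c5)
         (p23 : P c2 c3) (p24 : P c2 c4) (p25 : P c2 c5)
         (p34 : P c3 c4) (p35 : P c3 c5) (p45 : P c4 c5) where

  upper-triangle : ∀ i j → i < j → P i j
  upper-triangle zero (suc zero) _ = p12
  upper-triangle zero (suc (suc zero)) _ = p13
  upper-triangle zero (suc (suc (suc zero))) _ = p14
  upper-triangle zero (suc (suc (suc (suc zero)))) _ = p15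
  upper-triangle (suc zero) (suc (suc zero)) _ = p23
  upper-triangle (suc zero) (suc (suc (suc zero))) _ = p24
  upper-triangle (suc zero) (suc (suc (suc (suc zero)))) _ = p25
  upper-triangle (suc (suc zero)) (suc (suc (suc zero))) _ = p34
  upper-triangle (suc (suc zero)) (suc (suc (suc (suc zero)))) _ = p35
  upper-triangle (suc (suc (suc zero))) (suc (suc (suc (suc zero)))) _ = p45
  upper-triangle _ zero ()
  upper-triangle (suc _) (suc zero) (s≤s ())
  upper-triangle (suc (suc _)) (suc (suc zero)) (s≤s (s≤s ()))
  upper-triangle (suc (suc (suc _))) (suc (suc (suc zero))) (s≤s (s≤s (s≤s ())))
  upper-triangle (suc (suc (suc (suc _)))) (suc (suc (suc (suc zero)))) (s≤s (s≤s (s≤s (s≤s ()))))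

module InducedSubgraphs (G : Graph) where
  open Graph G renaming (sym to adj-sym)

  _~_ _≁_ : Fin n → Fin n → Set
  a ~ b = adj a b ≡ true
  a ≁ b = adj a b ≡ false

  adj-flip : ∀ {a b t} → adj a b ≡ t → adj b a ≡ t
  adj-flip {a} {b} = trans (adj-sym b a)

  ≁-intro : ∀ {a b} → ¬ a ~ b → a ≁ b
  ≁-intro = ¬-not

  ~-intro : ∀ {a b} → ¬ a ≁ b → a ~ b
  ~-intro = ¬-not

  induced-from-upper-triangle : ∀ {k} {h : Fin k → Fin k → Bool} → SimpleTwinFree h →
    (f : Fin k → Fin n) → (∀ i j → i < j → adj (f i) (f j) ≡ h i j) → ContainsInduced G k h
  induced-from-upper-triangle {h = h} (h-sym , h-irrefl , h-twinFree) f upper =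
    f , f-injective , f-induces
    where
    f-induces : ∀ i j → adj (f i) (f j) ≡ h i j
    f-induces i j with <-cmp i j
    ... | tri< i<j _ _ = upper i j i<j
    ... | tri≈ _ refl _ = trans (irrefl (f i)) (sym (h-irrefl i))
    ... | tri> _ _ j<i = trans (adj-flip (upper j i j<i)) (h-sym j i)

    f-injective : ∀ {i j} → f i ≡ f j → i ≡ j
    f-injective {i} {j} fi≡fj = h-twinFree i j λ l →
      trans (sym (f-induces i l)) (trans (cong (λ z → adj z (f l)) fi≡fj) (f-induces j l))

  module _ {a b c d e : Fin n} (h : Fin 5 → Fin 5 → Bool) (h-ok : SimpleTwinFree h)
           (ab : adj a b ≡ h c1 c2) (ac : adj a c ≡ h c1 c3) (ad : adj a d ≡ h c1 c4)
           (ae : adj a e ≡ h c1 c5) (bc : adj b c ≡ h c2 c3) (bd : adj b d ≡ h c2 c4)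
           (be : adj b e ≡ h c2 c5) (cd : adj c d ≡ h c3 c4) (ce : adj c e ≡ h c3 c5)
           (de : adj d e ≡ h c4 c5) where

    induced-five : ContainsInduced G 5 h
    induced-five = induced-from-upper-triangle h-ok f
      (upper-triangle {P = λ i j → adj (f i) (f j) ≡ h i j} ab ac ad ae bc bd be cd ce de)
      where
      f : Fin 5 → Fin n
      f = lookup (a ∷ b ∷ c ∷ d ∷ e ∷ [])

  no-induced-P5 : Free G 5 P5adj → ∀ {a b c d e} →
    a ~ b → b ~ c → c ~ d → d ~ e →
    a ≁ c → a ≁ d → a ≁ e → b ≁ d → b ≁ e → c ≁ e → ⊥
  no-induced-P5 free ab bc cd de ac ad ae bd be ce =
    free (induced-five P5adj P5adj-simpleTwinFree ab ac ad ae bc bd be cd ce de)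

  no-induced-HVN : Free G 5 HVNadj → ∀ {a b c d e} →
    a ~ b → a ~ c → a ~ d → b ~ c → b ~ d → c ~ d →
    a ~ e → b ~ e → c ≁ e → d ≁ e → ⊥
  no-induced-HVN free ab ac ad bc bd cd ae be ce de =
    free (induced-five HVNadj HVNadj-simpleTwinFree ab ac ad ae bc bd be cd ce de)

  unstable⇒stable-if-edges-exclusive : (A B : Fin n → Set) →
    (∀ {a b c d} → A a → A b → a ~ b → B c → B d → c ~ d → ⊥) →
    ¬ Stable G A → Stable G B
  unstable⇒stable-if-edges-exclusive A B exclusive A-unstable c d Bc Bd = ≁-intro λ cd →
    A-unstable λ a b Aa Ab → ≁-intro λ ab → exclusive Aa Ab ab Bc Bd cd

  module _ (hvn-free : Free G 5 HVNadj) (A : Fin n → Set) {a b c : Fin n} (ab : a ~ b) where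

    stable-seeing-edge-and-far-vertex : a ≁ c → b ≁ c →
      (∀ {u} → A u → u ~ a × u ~ b × u ~ c) → Stable G A
    stable-seeing-edge-and-far-vertex ac bc sees u w Au Aw = ≁-intro λ uw →
      let (ua , ub , uc) = sees Au ; (wa , wb , wc) = sees Aw in
      no-induced-HVN hvn-free uw ua ub wa wb ab uc wc ac bc

    stable-seeing-edge-missing-apex : a ~ c → b ~ c →
      (∀ {u} → A u → u ~ a × u ~ b × u ≁ c) → Stable G A
    stable-seeing-edge-missing-apex ac bc sees u w Au Aw = ≁-intro λ uw →
      let (ua , ub , uc) = sees Au ; (wa , wb , wc) = sees Aw in
      no-induced-HVN hvn-free ab (adj-flip ua) (adj-flip wa) (adj-flip ub) (adj-flip wb) uw
        ac bc uc wc

-- the vertex of C opposite the edge vₚvₚ₊₁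
opposite : Fin 5 → Fin 5
opposite p = next (next (next p))

C5-edge-and-opposite : ∀ p →
  C5adj p (next p) ≡ true × C5adj p (opposite p) ≡ false × C5adj (next p) (opposite p) ≡ false
C5-edge-and-opposite zero = refl , refl , refl
C5-edge-and-opposite (suc zero) = refl , refl , refl
C5-edge-and-opposite (suc (suc zero)) = refl , refl , refl
C5-edge-and-opposite (suc (suc (suc zero))) = refl , refl , refl
C5-edge-and-opposite (suc (suc (suc (suc zero)))) = refl , refl , refl

module Wheel {G : Graph} (p5-free : Free G 5 P5adj) (hvn-free : Free G 5 HVNadj) (W : TWheel G) where
  open Graph G using (n; adj)
  open TWheel W
  open Classes W
  open InducedSubgraphs G

  Cls-adj : ∀ {b S u} → Cls b S u → ∀ j → adj u (v j) ≡ S j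
  Cls-adj = proj₂ ∘ proj₂

  edge+opposite⇒Cls-stable : ∀ b S p →
    S p ≡ true → S (next p) ≡ true → S (opposite p) ≡ true → Stable G (Cls b S)
  edge+opposite⇒Cls-stable b S p Sp Snext Sopp =
    let (edge , far , far′) = C5-edge-and-opposite p in
    stable-seeing-edge-and-far-vertex hvn-free (Cls b S) (trans (cycle p (next p)) edge)
      (trans (cycle p (opposite p)) far) (trans (cycle (next p) (opposite p)) far′)
      λ Cu → trans (Cls-adj Cu p) Sp , trans (Cls-adj Cu (next p)) Snext ,
             trans (Cls-adj Cu (opposite p)) Sopp

  Y-P-T-stable :
    Stable G (Y c2) × Stable G (Y c5) × Stable G (Yx c1) × Stable G (P c2)
    × Stable G (P c3) × Stable G (P c4) × Stable G (Px c3) × Stable G T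
  Y-P-T-stable =
    edge+opposite⇒Cls-stable false (patY c2) c4 refl refl refl ,
    edge+opposite⇒Cls-stable false (patY c5) c2 refl refl refl ,
    edge+opposite⇒Cls-stable true (patY c1) c3 refl refl refl ,
    edge+opposite⇒Cls-stable false (patP c2) c1 refl refl refl ,
    edge+opposite⇒Cls-stable false (patP c3) c2 refl refl refl ,
    edge+opposite⇒Cls-stable false (patP c4) c3 refl refl refl ,
    edge+opposite⇒Cls-stable true (patP c3) c2 refl refl refl ,
    edge+opposite⇒Cls-stable false (λ _ → true) c1 refl refl refl

  Rx2∪Rx5-stable : Stable G (Rx c2 ∪ Rx c5)
  Rx2∪Rx5-stable =
    stable-seeing-edge-missing-apex hvn-free (Rx c2 ∪ Rx c5) (x-nbrs c1) (x-nbrs c2) (cycle c1 c2)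
      [ sees , sees ]′
    where
    sees : ∀ {S u} → Cls true S u → u ~ x × adj u (v c1) ≡ S c1 × adj u (v c2) ≡ S c2
    sees (_ , ux , uN) = ux , uN c1 , uN c2

  -- {w, v₃, u, v₄} is a K4 and v₂ sees only w and v₃ in it
  Yx1-anticomplete-Rbar3∪Rbarx3 : Anticomplete G (Yx c1) (Rbar c3 ∪ Rbarx c3)
  Yx1-anticomplete-Rbar3∪Rbarx3 u w (_ , _ , uN) Bw = ≁-intro λ uw →
    let wN = [ Cls-adj , Cls-adj ]′ Bw in
    no-induced-HVN hvn-free (wN c3) (adj-flip uw) (wN c4) (adj-flip (uN c3)) (cycle c3 c4)
      (uN c4) (wN c2) (cycle c3 c2) (uN c2) (cycle c4 c2)

  R3-family : Fin n → Set
  R3-family = R c3 ∪ Rbar c3 ∪ Rbarx c3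

  R3-family-adj : ∀ {u} → R3-family u → u ~ v c2 × u ≁ v c1 × u ≁ v c5
  R3-family-adj = [ nbrs , [ nbrs , nbrs ]′ ]′
    where
    nbrs : ∀ {b S u} → Cls b S u → adj u (v c2) ≡ S c2 × adj u (v c1) ≡ S c1 × adj u (v c5) ≡ S c5
    nbrs Cu = Cls-adj Cu c2 , Cls-adj Cu c1 , Cls-adj Cu c5

  R4-complete-to : ∀ {c u} → R c4 c → u ~ v c2 → u ≁ v c1 → u ≁ v c5 → c ~ u
  R4-complete-to (_ , _ , cN) u2 u1 u5 = ~-intro λ cu →
    no-induced-P5 p5-free (cN c5) (cycle c5 c1) (cycle c1 c2) (adj-flip u2)
      (cN c1) (cN c2) cu (cycle c5 c2) (adj-flip u5) (adj-flip u1)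

  R3-family-edge-excludes-R4-edge : ∀ {a b c d} →
    R3-family a → R3-family b → a ~ b → R c4 c → R c4 d → c ~ d → ⊥
  R3-family-edge-excludes-R4-edge Qa Qb ab Rc Rd cd =
    let (a2 , a1 , a5) = R3-family-adj Qa ; (b2 , b1 , b5) = R3-family-adj Qb in
    no-induced-HVN hvn-free ab
      (adj-flip (R4-complete-to Rc a2 a1 a5)) (adj-flip (R4-complete-to Rd a2 a1 a5))
      (adj-flip (R4-complete-to Rc b2 b1 b5)) (adj-flip (R4-complete-to Rd b2 b1 b5))
      cd a2 b2 (Cls-adj Rc c2) (Cls-adj Rd c2)

  R3-unstable⇒R4-stable : ¬ Stable G (R c3) → Stable G (R c4)
  R3-unstable⇒R4-stable = unstable⇒stable-if-edges-exclusive (R c3) (R c4) λ Ra Rb →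
    R3-family-edge-excludes-R4-edge (inj₁ Ra) (inj₁ Rb)

  R4-unstable⇒R3-family-stable : ¬ Stable G (R c4) → Stable G R3-family
  R4-unstable⇒R3-family-stable = unstable⇒stable-if-edges-exclusive (R c4) R3-family
    λ Ra Rb ab Qc Qd cd → R3-family-edge-excludes-R4-edge Qc Qd cd Ra Rb ab

lemma3p3 : (G : Graph) → Connected G → Free G 5 P5adj → Free G 5 HVNadj →
    (W : TWheel G) →
    let open Classes W in
    ((¬ Stable G (R c3) → Stable G (R c4))
      × (¬ Stable G (R c4) → Stable G (R c3 ∪ Rbar c3 ∪ Rbarx c3)))
    × Stable G (Rx c2 ∪ Rx c5)
    × (Stable G (Y c2) × Stable G (Y c5) × Stable G (Yx c1) × Stable G (P c2)
      × Stable G (P c3) × Stable G (P c4) × Stable G (Px c3) × Stable G T)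
    × Anticomplete G (Yx c1) (Rbar c3 ∪ Rbarx c3)
lemma3p3 G _ p5-free hvn-free W =
  (R3-unstable⇒R4-stable , R4-unstable⇒R3-family-stable) ,
  Rx2∪Rx5-stable ,
  Y-P-T-stable ,
  Yx1-anticomplete-Rbar3∪Rbarx3
  where open Wheel p5-free hvn-free W
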